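{- Let $S$ be a posemigroup. The s$\ell$-semigroup $\mathrm{Id}\,S$ is cancellative if and only if for every $n\geq1$ and all $x_1,\dots,x_n,y,z_1,\dots,z_n\in S$ the following two implications hold in $S$: $x_1y\leq x_2z_2\ \&\ \dots\ \&\ x_{n-1}y\leq x_nz_n\ \&\ x_ny\leq x_1z_1\implies y\leq z_i$ for some $i$; $yx_1\leq z_2x_2\ \&\ \dots\ \&\ yx_{n-1}\leq z_nx_n\ \&\ yx_n\leq z_1x_1\implies y\leq z_i$ for some $i$.
   Context: A posemigroup is a semigroup with a partial order for which multiplication is isotone in both arguments. $\mathrm{Id}\,S$ denotes the set of non-empty finitely generated downsets $\downarrow\{x_1,\dots,x_m\}$ of $S$, ordered by inclusion, with join given by union and multiplication $X\ast Y:=\downarrow\{xy: x\in X, y\in Y\}$; it is an s$\ell$-semigroup (a join semilattice with a semigroup multiplication distributing over binary joins on both sides). An s$\ell$-semigroup is cancellative if $ax\leq bx\Rightarrow a\leq b$ and $xa\leq xb\Rightarrow a\leq b$. -}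

module Defs where

open import Level using (Level; _⊔_)
open import Data.Nat using (ℕ)
open import Data.Fin using (Fin; zero; suc)
open import Data.Product using (Σ; ∃; _×_; _,_)
open import Data.List.NonEmpty using (List⁺; toList)
open import Data.List.Relation.Unary.Any using (Any)
open import Relation.Binary.PropositionalEquality using (_≡_)
open import Relation.Binary.Structures using (IsPartialOrder)
open import Function.Bundles using (_⇔_)

record Posemigroup (c ℓ : Level) : Set (Level.suc (c ⊔ ℓ)) where
  infixl 7 _∙_
  infix 4 _≤_
  field
    Carrier        : Set c
    _≤_            : Carrier → Carrier → Set ℓ
    _∙_            : Carrier → Carrier → Carrier
    isPartialOrder : IsPartialOrder _≡_ _≤_
    assoc          : ∀ x y z → (x ∙ y) ∙ z ≡ x ∙ (y ∙ z)
    mono           : ∀ {a b x y} → a ≤ b → x ≤ y → a ∙ x ≤ b ∙ y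

module _ {c ℓ : Level} (S : Posemigroup c ℓ) where
  open Posemigroup S

  Subset : Set (Level.suc (c ⊔ ℓ))
  Subset = Carrier → Set (c ⊔ ℓ)

  ↓gen : List⁺ Carrier → Subset
  ↓gen gs x = Any (λ g → x ≤ g) (toList gs)

  -- Id S: non-empty finitely generated downsets ↓{x₁,…,xₘ} (m ≥ 1)
  record IdS : Set (Level.suc (c ⊔ ℓ)) where
    field
      carrier   : Subset
      gens      : List⁺ Carrier
      generated : ∀ x → carrier x ⇔ ↓gen gens x
  open IdS public

  _⊑_ : IdS → IdS → Set (c ⊔ ℓ)
  X ⊑ Y = ∀ x → carrier X x → carrier Y x

  _∗_ : IdS → IdS → Subset
  (X ∗ Y) w = Σ Carrier λ x → Σ Carrier λ y → carrier X x × carrier Y y × w ≤ x ∙ y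

  _⊆_ : Subset → Subset → Set (c ⊔ ℓ)
  A ⊆ B = ∀ x → A x → B x

  IdCancellative : Set (Level.suc (c ⊔ ℓ))
  IdCancellative =
    (∀ A B X → (A ∗ X) ⊆ (B ∗ X) → A ⊑ B) ×
    (∀ A B X → (X ∗ A) ⊆ (X ∗ B) → A ⊑ B)

-- cyclic successor on Fin (suc m): i ↦ i + 1 mod (m+1)
next : ∀ {m} → Fin (ℕ.suc m) → Fin (ℕ.suc m)
next {ℕ.zero}  zero    = zero
next {ℕ.suc m} zero    = suc zero
next {ℕ.suc m} (suc i) with next {m} i
... | zero  = zero
... | suc j = suc (suc j)

module _ {c ℓ : Level} (S : Posemigroup c ℓ) where
  open Posemigroup S

  -- the right condition (first implication), for n = m+1
  RightCond : Set (c ⊔ ℓ)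
  RightCond = ∀ m (x : Fin (ℕ.suc m) → Carrier) (y : Carrier) (z : Fin (ℕ.suc m) → Carrier) →
    (∀ i → x i ∙ y ≤ x (next i) ∙ z (next i)) → ∃ λ i → y ≤ z i

  -- the left condition (second implication), for n = m+1
  LeftCond : Set (c ⊔ ℓ)
  LeftCond = ∀ m (x : Fin (ℕ.suc m) → Carrier) (y : Carrier) (z : Fin (ℕ.suc m) → Carrier) →
    (∀ i → y ∙ x i ≤ z (next i) ∙ x (next i)) → ∃ λ i → y ≤ z i

{-# OPTIONS --safe #-}
-- Forward: cancel X = ↓{x₁,…,xₙ} from X ∗ ↓{y} ⊆ X ∗ ↓{z₁,…,zₙ}.
-- Backward: if X ∗ A ⊆ X ∗ B and a ∈ A, each generator x of X satisfies
-- x a ≤ x' b with x' another generator and b ∈ B. Following x ↦ x' from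
-- any generator eventually returns to a generator already visited, and the
-- cycle so obtained is an instance of the hypothesis, giving a ≤ b ∈ B.
-- The left-hand version is the right-hand one for the opposite posemigroup.
module Submission where

open import Defs
open import Level using (Level; _⊔_)
open import Data.Nat using (ℕ; zero; suc; _+_)
open import Data.Nat.Properties using (+-suc; +-comm; n<1+n; m≤n⇒∃[o]m+o≡n)
open import Data.Nat.GeneralisedArithmetic using (fold; fold-+)
open import Data.Fin using (Fin; toℕ)
open import Data.Fin.Properties using (pigeonhole)
open import Data.Product using (∃; ∃₂; _×_; _,_; proj₁; proj₂)
open import Data.Sum using (_⊎_; inj₁; inj₂)
open import Data.List using (length; lookup; tabulate)
open import Data.List.NonEmpty using (List⁺; toList; _∷_)
open import Data.List.Relation.Unary.Any as Any using (Any)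
open import Data.List.Relation.Unary.Any.Properties using (tabulate⁺; tabulate⁻; lookup-index)
open import Data.List.Membership.Propositional using (lose)
open import Data.List.Membership.Propositional.Properties using (∈-lookup)
open import Function.Base using (_∘′_)
open import Function.Bundles using (_⇔_; mk⇔; Equivalence)
open import Relation.Binary.PropositionalEquality
  using (_≡_; refl; sym; trans; cong; subst; module ≡-Reasoning)
open import Relation.Binary.Structures using (IsPartialOrder)

toℕ-next : ∀ {m} (i : Fin (suc m)) →
  toℕ (next i) ≡ suc (toℕ i) ⊎ (toℕ (next i) ≡ 0 × toℕ i ≡ m)
toℕ-next {zero}  Fin.zero    = inj₂ (refl , refl)
toℕ-next {suc m} Fin.zero    = inj₁ refl
toℕ-next {suc m} (Fin.suc i) with next i | toℕ-next i
... | Fin.zero  | inj₂ (_ , i≡m) = inj₂ (refl , cong suc i≡m)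
... | Fin.suc j | inj₁ e         = inj₁ (cong suc e)

fold-periodic : ∀ {a} {A : Set a} (f : A → A) {x : A} {m : ℕ} →
  fold x f (suc m) ≡ x → ∀ t → fold x f (t + suc m) ≡ fold x f t
fold-periodic f {x} period t =
  trans (fold-+ x f t) (cong (λ x′ → fold x′ f t) period)

periodicPoint : ∀ {k} (f : Fin (suc k) → Fin (suc k)) →
  ∃₂ λ x m → fold x f (suc m) ≡ x
periodicPoint f with pigeonhole (n<1+n _) (λ t → fold Fin.zero f (toℕ t))
... | i , j , i<j , same with m≤n⇒∃[o]m+o≡n i<j
...   | o , 1+i+o≡j = fold Fin.zero f (toℕ i) , o , returns
  where
  open ≡-Reasoning
  returns : fold (fold Fin.zero f (toℕ i)) f (suc o) ≡ fold Fin.zero f (toℕ i)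
  returns = begin
    fold (fold Fin.zero f (toℕ i)) f (suc o) ≡⟨ sym (fold-+ Fin.zero f (suc o)) ⟩
    fold Fin.zero f (suc o + toℕ i)          ≡⟨ cong (fold Fin.zero f) (trans (cong suc (+-comm o (toℕ i))) 1+i+o≡j) ⟩
    fold Fin.zero f (toℕ j)                  ≡⟨ sym same ⟩
    fold Fin.zero f (toℕ i)                  ∎

_ᵒᵖ : ∀ {c ℓ} → Posemigroup c ℓ → Posemigroup c ℓ
S ᵒᵖ = record
  { Carrier        = Carrier
  ; _≤_            = _≤_
  ; _∙_            = λ x y → y ∙ x
  ; isPartialOrder = isPartialOrder
  ; assoc          = λ x y z → sym (assoc z y x)
  ; mono           = λ a≤b x≤y → mono x≤y a≤b
  }
  where open Posemigroup S

module _ {c ℓ : Level} (S : Posemigroup c ℓ) where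
  LeftCancellative : Set (Level.suc (c ⊔ ℓ))
  LeftCancellative = ∀ A B X → _⊆_ S (_∗_ S X A) (_∗_ S X B) → _⊑_ S A B

  RightCancellative : Set (Level.suc (c ⊔ ℓ))
  RightCancellative = ∀ A B X → _⊆_ S (_∗_ S A X) (_∗_ S B X) → _⊑_ S A B

module Cancellation {c ℓ : Level} (S : Posemigroup c ℓ) where
  open Posemigroup S
  open IsPartialOrder isPartialOrder using () renaming (refl to ≤-refl; trans to ≤-trans)

  downClosed : (X : IdS S) {x y : Carrier} → x ≤ y → carrier X y → carrier X x
  downClosed X {x} {y} x≤y y∈X = from (Any.map (≤-trans x≤y) (to y∈X))
    where open Equivalence (generated X x) using (from)
          open Equivalence (generated X y) using (to)

  ↓fin : ∀ {m} → (Fin (suc m) → Carrier) → IdS S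
  ↓fin x = record
    { carrier   = ↓gen S gs
    ; gens      = gs
    ; generated = λ _ → mk⇔ (λ p → p) (λ p → p)
    }
    where
    gs : List⁺ Carrier
    gs = x Fin.zero ∷ tabulate (λ i → x (Fin.suc i))

  ∈↓fin : ∀ {m} (x : Fin (suc m) → Carrier) (i : Fin (suc m)) → carrier (↓fin x) (x i)
  ∈↓fin x i = tabulate⁺ {f = x} i ≤-refl

  generator : (X : IdS S) → Fin (suc (length (List⁺.tail (gens X)))) → Carrier
  generator X = lookup (toList (gens X))

  generator∈ : (X : IdS S) (i : Fin _) → carrier X (generator X i)
  generator∈ X i = Equivalence.from (generated X _) (lose (∈-lookup i) ≤-refl)

  below-generator : (X : IdS S) {x : Carrier} → carrier X x → ∃ λ i → x ≤ generator X i
  below-generator X x∈X = let p = Equivalence.to (generated X _) x∈X in Any.index p , lookup-index p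

  leftCancellative⇒rightCond : LeftCancellative S → RightCond S
  leftCancellative⇒rightCond cancel m x y z chain =
    tabulate⁻ (cancel (↓fin {0} λ _ → y) (↓fin z) (↓fin x) included y (∈↓fin (λ _ → y) Fin.zero))
    where
    included : _⊆_ S (_∗_ S (↓fin x) (↓fin {0} λ _ → y)) (_∗_ S (↓fin x) (↓fin z))
    included w (x′ , y′ , x′∈X , y′≤y , w≤x′y′)
      with tabulate⁻ {f = x} x′∈X | tabulate⁻ {f = λ (_ : Fin 1) → y} y′≤y
    ... | i , x′≤xᵢ | _ , y′≤y =
      x (next i) , z (next i) , ∈↓fin x (next i) , ∈↓fin z (next i) ,
      ≤-trans w≤x′y′ (≤-trans (mono x′≤xᵢ y′≤y) (chain i))

  -- The cycle has xᵢ = u i and zᵢ = v (i + m), the term of v one step before i.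
  rightCond-periodic : RightCond S → ∀ m (u v : ℕ → Carrier) (y : Carrier) →
    (∀ t → u (t + suc m) ≡ u t) → (∀ t → v (t + suc m) ≡ v t) →
    (∀ t → u t ∙ y ≤ u (suc t) ∙ v t) → ∃ λ t → y ≤ v t
  rightCond-periodic rc m u v y u-period v-period chain
    with rc m (λ i → u (toℕ i)) y (λ i → v (toℕ i + m)) cyclic
    where
    cyclic : ∀ i → u (toℕ i) ∙ y ≤ u (toℕ (next i)) ∙ v (toℕ (next i) + m)
    cyclic i with toℕ (next i) | toℕ-next i
    ... | _ | inj₁ refl =
      subst (λ v′ → u (toℕ i) ∙ y ≤ u (suc (toℕ i)) ∙ v′)
            (sym (trans (cong v (sym (+-suc (toℕ i) m))) (v-period (toℕ i))))
            (chain (toℕ i))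
    ... | _ | inj₂ (refl , i≡m) rewrite i≡m =
      subst (λ u′ → u m ∙ y ≤ u′ ∙ v m) (u-period 0) (chain m)
  ... | i , y≤v = toℕ i + m , y≤v

  rightCond-finite : ∀ {p} → RightCond S → ∀ {k} (xs : Fin (suc k) → Carrier) (a : Carrier)
    (P : Carrier → Set p) → (∀ j → ∃₂ λ i b → P b × xs j ∙ a ≤ xs i ∙ b) →
    ∃ λ b → P b × a ≤ b
  rightCond-finite rc {k} xs a P step =
    let x₀ , m , period = periodicPoint succ
        t , a≤b = rightCond-periodic rc m (λ t → xs (fold x₀ succ t)) (λ t → witness (fold x₀ succ t)) a
                    (λ t → cong xs (fold-periodic succ period t))
                    (λ t → cong witness (fold-periodic succ period t))
                    (λ t → ordered (fold x₀ succ t))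
    in witness (fold x₀ succ t) , witness∈P (fold x₀ succ t) , a≤b
    where
    succ : Fin (suc k) → Fin (suc k)
    succ j = proj₁ (step j)
    witness : Fin (suc k) → Carrier
    witness j = proj₁ (proj₂ (step j))
    witness∈P : ∀ j → P (witness j)
    witness∈P j = proj₁ (proj₂ (proj₂ (step j)))
    ordered : ∀ j → xs j ∙ a ≤ xs (succ j) ∙ witness j
    ordered j = proj₂ (proj₂ (proj₂ (step j)))

  rightCond⇒leftCancellative : RightCond S → LeftCancellative S
  rightCond⇒leftCancellative rc A B X included a a∈A =
    let b , b∈B , a≤b = rightCond-finite rc (generator X) a (carrier B) step
    in downClosed B a≤b b∈B
    where
    step : ∀ j → ∃₂ λ i b → carrier B b × generator X j ∙ a ≤ generator X i ∙ b
    step j with included _ (generator X j , a , generator∈ X j , a∈A , ≤-refl)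
    ... | x , b , x∈X , b∈B , xⱼa≤xb with below-generator X x∈X
    ...   | i , x≤xᵢ = i , b , b∈B , ≤-trans xⱼa≤xb (mono x≤xᵢ ≤-refl)

  leftCancellative⇔rightCond : LeftCancellative S ⇔ RightCond S
  leftCancellative⇔rightCond = mk⇔ leftCancellative⇒rightCond rightCond⇒leftCancellative

module Opposite {c ℓ : Level} (S : Posemigroup c ℓ) where
  open Posemigroup S

  toᵒᵖ : IdS S → IdS (S ᵒᵖ)
  toᵒᵖ X = record { carrier = carrier X ; gens = gens X ; generated = generated X }

  fromᵒᵖ : IdS (S ᵒᵖ) → IdS S
  fromᵒᵖ X = record { carrier = carrier X ; gens = gens X ; generated = generated X }

  private
    swap-∃₂ : ∀ {p q r} {P : Carrier → Set p} {Q : Carrier → Set q} {R : Carrier → Carrier → Set r} →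
      (∃₂ λ x y → P x × Q y × R x y) → ∃₂ λ y x → Q y × P x × R x y
    swap-∃₂ (x , y , px , qy , rxy) = y , x , qy , px , rxy

  rightCancellative⇔leftCancellativeᵒᵖ : RightCancellative S ⇔ LeftCancellative (S ᵒᵖ)
  rightCancellative⇔leftCancellativeᵒᵖ = mk⇔
    (λ cancel A B X included →
      cancel (fromᵒᵖ A) (fromᵒᵖ B) (fromᵒᵖ X) (λ w → swap-∃₂ ∘′ included w ∘′ swap-∃₂))
    (λ cancel A B X included →
      cancel (toᵒᵖ A) (toᵒᵖ B) (toᵒᵖ X) (λ w → swap-∃₂ ∘′ included w ∘′ swap-∃₂))

mainTheorem16 : ∀ {c ℓ : Level} (S : Posemigroup c ℓ) →
    IdCancellative S ⇔ (RightCond S × LeftCond S)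
mainTheorem16 S = mk⇔
  (λ (right , left) → to leftS left , to leftSᵒᵖ (to rightS⇔leftSᵒᵖ right))
  (λ (rc , lc) → from rightS⇔leftSᵒᵖ (from leftSᵒᵖ lc) , from leftS rc)
  where
  open Equivalence
  open Cancellation using (leftCancellative⇔rightCond)
  leftS : LeftCancellative S ⇔ RightCond S
  leftS = leftCancellative⇔rightCond S
  leftSᵒᵖ : LeftCancellative (S ᵒᵖ) ⇔ LeftCond S
  leftSᵒᵖ = leftCancellative⇔rightCond (S ᵒᵖ)
  rightS⇔leftSᵒᵖ : RightCancellative S ⇔ LeftCancellative (S ᵒᵖ)
  rightS⇔leftSᵒᵖ = Opposite.rightCancellative⇔leftCancellativeᵒᵖ S
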